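{- Let $a,n$ be integers with $1\le a<n$ and $\gcd(a,n)=1$, let $[q_0,q_1,\dots,q_m]$ be the continued fraction of $n/a$, and define $\mathbf{v}_{ -2}=(1,0)$, $\mathbf{v}_{ -1}=(0,1)$, $\mathbf{v}_i=\mathbf{v}_{i-2}+q_i\mathbf{v}_{i-1}$ for $0\le i\le m$. For $i=0,1,\dots,m$ let $T_i$ be the triangle with vertices $(0,0)$, $\mathbf{v}_{i-2}$, $\mathbf{v}_i$. Then: (1) the closed line segment from $\mathbf{v}_{i-2}$ to $\mathbf{v}_i$ contains exactly $q_i+1$ lattice points; (2) $T_i$ contains no lattice points in its interior; (3) every lattice point of $T_i$ that is not a vertex of $T_i$ lies on the segment from $\mathbf{v}_{i-2}$ to $\mathbf{v}_i$.
   Context: The continued fraction $[q_0,\dots,q_m]$ of $n/a$ is the finite expansion $n/a=q_0+1/(q_1+1/(\cdots+1/q_m))$ whose partial quotients are the successive quotients of the Euclidean algorithm applied to $n$ and $a$. -}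

module Defs where

open import Data.Nat as ℕ using (ℕ; zero; suc)
open import Data.Nat.DivMod using (_/_; _%_)
open import Data.Integer as ℤ using (ℤ; +_)
open import Data.Rational as ℚ using (ℚ; 0ℚ; 1ℚ)
open import Data.Product using (_×_; _,_; Σ-syntax; ∃-syntax)
open import Data.List using (List; []; _∷_)

-- Continued fraction of n/a: partial quotients of the Euclidean algorithm
-- on (n , a).  The first argument is fuel; fuel ≥ a suffices because the
-- second argument strictly decreases (n % a < a).
cfAux : ℕ → ℕ → ℕ → List ℕ
cfAux zero    n a       = []
cfAux (suc f) n zero    = []
cfAux (suc f) n (suc k) = (n / suc k) ∷ cfAux f (suc k) (n % suc k)

cf : ℕ → ℕ → List ℕ
cf n a = cfAux a n a

-- k-th entry of a list (default 0 outside the range; never used there).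
qAt : List ℕ → ℕ → ℕ
qAt []       k       = 0
qAt (q ∷ qs) zero    = q
qAt (q ∷ qs) (suc k) = qAt qs k

Point : Set
Point = ℤ × ℤ

-- V qs k = 𝐯_{k-2}:  V 0 = 𝐯₋₂ = (1,0), V 1 = 𝐯₋₁ = (0,1),
-- V (k+2) = 𝐯_k = 𝐯_{k-2} + q_k 𝐯_{k-1}.
V : List ℕ → ℕ → Point
V qs zero = (+ 1 , + 0)
V qs (suc zero) = (+ 0 , + 1)
V qs (suc (suc k)) with V qs k | V qs (suc k)
... | (x₀ , y₀) | (x₁ , y₁) =
  (x₀ ℤ.+ + qAt qs k ℤ.* x₁ , y₀ ℤ.+ + qAt qs k ℤ.* y₁)

⟦_⟧ : ℤ → ℚ
⟦ z ⟧ = z ℚ./ 1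

OnSegment : Point → Point → Point → Set
OnSegment (ux , uy) (wx , wy) (px , py) =
  Σ[ t ∈ ℚ ] (0ℚ ℚ.≤ t × t ℚ.≤ 1ℚ
    × ⟦ px ⟧ ≡ (1ℚ ℚ.- t) ℚ.* ⟦ ux ⟧ ℚ.+ t ℚ.* ⟦ wx ⟧
    × ⟦ py ⟧ ≡ (1ℚ ℚ.- t) ℚ.* ⟦ uy ⟧ ℚ.+ t ℚ.* ⟦ wy ⟧)
  where open import Relation.Binary.PropositionalEquality using (_≡_)

InTriangle : Point → Point → Point → Set
InTriangle (ux , uy) (wx , wy) (px , py) =
  Σ[ s ∈ ℚ ] Σ[ t ∈ ℚ ] (0ℚ ℚ.≤ s × 0ℚ ℚ.≤ t × s ℚ.+ t ℚ.≤ 1ℚ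
    × ⟦ px ⟧ ≡ s ℚ.* ⟦ ux ⟧ ℚ.+ t ℚ.* ⟦ wx ⟧
    × ⟦ py ⟧ ≡ s ℚ.* ⟦ uy ⟧ ℚ.+ t ℚ.* ⟦ wy ⟧)
  where open import Relation.Binary.PropositionalEquality using (_≡_)

-- p lies in the interior of the triangle with vertices (0,0), u, w
-- (u, w linearly independent, which holds for the T_i):
-- p = s u + t w with s, t > 0, s + t < 1.
InInterior : Point → Point → Point → Set
InInterior (ux , uy) (wx , wy) (px , py) =
  Σ[ s ∈ ℚ ] Σ[ t ∈ ℚ ] (0ℚ ℚ.< s × 0ℚ ℚ.< t × s ℚ.+ t ℚ.< 1ℚ
    × ⟦ px ⟧ ≡ s ℚ.* ⟦ ux ⟧ ℚ.+ t ℚ.* ⟦ wx ⟧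
    × ⟦ py ⟧ ≡ s ℚ.* ⟦ uy ⟧ ℚ.+ t ℚ.* ⟦ wy ⟧)
  where open import Relation.Binary.PropositionalEquality using (_≡_)

{-# OPTIONS --safe #-}

-- Since det (v , u + q v) = - det (u , v), consecutive vectors v_{i-2}, v_{i-1}
-- have determinant ±1, so by Cramer's rule every lattice point has integral
-- coordinates in the basis (v_{i-2}, v_{i-1}).  As v_i = v_{i-2} + q_i v_{i-1},
-- the point s v_{i-2} + t v_i has coordinates (s + t , t q_i).  On T_i the
-- first coordinate is an integer in [0, 1]: it is never strictly between, it is
-- 0 only at the origin, and it is 1 exactly on the edge [v_{i-2}, v_i], whose
-- lattice points are therefore v_{i-2} + j v_{i-1} for 0 ≤ j ≤ q_i.
module Submission where

open import Defs
open import Data.Nat using (ℕ; suc; _≤_; _<_)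
open import Data.Nat.GCD using (gcd)
open import Data.Integer using (+_)
open import Data.Fin using (Fin; toℕ)
open import Data.List using (List; length; lookup)
open import Data.List.Membership.Propositional using (_∈_)
open import Data.List.Relation.Unary.All using (All)
open import Data.List.Relation.Unary.Unique.Propositional using (Unique)
open import Data.Product using (_×_; _,_; ∃-syntax)
open import Relation.Binary.PropositionalEquality using (_≡_; _≢_)
open import Relation.Nullary using (¬_)

import Data.Nat as ℕ
import Data.Nat.Properties as ℕ
open import Data.Nat.Coprimality using (1-coprimeTo) renaming (sym to coprime-sym)
open import Data.Integer as ℤ using (ℤ; -[1+_])
import Data.Integer.Properties as ℤ
open import Data.Integer.Solver using (module +-*-Solver)
open import Data.Rational as ℚ using (ℚ; mkℚ; 0ℚ; 1ℚ)
import Data.Rational.Properties as ℚ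
import Data.Rational.Unnormalised as ℚᵘ
open import Data.Rational.Solver renaming (module +-*-Solver to ℚ-Solver)
open import Data.List using (_∷_; applyUpTo)
import Data.List.Properties as List
open import Data.List.Membership.Propositional.Properties using (∈-applyUpTo⁺)
import Data.List.Relation.Unary.All.Properties as All
import Data.List.Relation.Unary.Unique.Propositional.Properties as Unique
open import Data.Empty using (⊥; ⊥-elim)
open import Data.Sum using (_⊎_; inj₁; inj₂)
open import Data.Product using (proj₁; proj₂)
open import Relation.Binary.PropositionalEquality
  using (refl; sym; trans; cong; cong₂; subst; subst₂; module ≡-Reasoning)

open ≡-Reasoning

-- ⟦ z ⟧ is a normalised fraction with denominator 1, so once it is exposed as
-- such, ℚ's operations on it compute.
⟦⟧≡mkℚ : ∀ z → ⟦ z ⟧ ≡ mkℚ z 0 (coprime-sym (1-coprimeTo ℤ.∣ z ∣))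
⟦⟧≡mkℚ z = ℚ.toℚᵘ-injective (ℚ.toℚᵘ-fromℚᵘ (ℚᵘ.mkℚᵘ z 0))

⟦⟧-injective : ∀ {x y} → ⟦ x ⟧ ≡ ⟦ y ⟧ → x ≡ y
⟦⟧-injective {x} {y} eq rewrite ⟦⟧≡mkℚ x | ⟦⟧≡mkℚ y = cong ℚ.↥_ eq

⟦⟧-homo-* : ∀ x y → ⟦ x ℤ.* y ⟧ ≡ ⟦ x ⟧ ℚ.* ⟦ y ⟧
⟦⟧-homo-* x y rewrite ⟦⟧≡mkℚ x | ⟦⟧≡mkℚ y = refl

⟦⟧-homo-+ : ∀ x y → ⟦ x ℤ.+ y ⟧ ≡ ⟦ x ⟧ ℚ.+ ⟦ y ⟧
⟦⟧-homo-+ x y rewrite ⟦⟧≡mkℚ x | ⟦⟧≡mkℚ y =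
  cong (ℚ._/ 1) (sym (cong₂ ℤ._+_ (ℤ.*-identityʳ x) (ℤ.*-identityʳ y)))

⟦⟧-homo‿- : ∀ x → ⟦ ℤ.- x ⟧ ≡ ℚ.- ⟦ x ⟧
⟦⟧-homo‿- x rewrite ⟦⟧≡mkℚ x | ⟦⟧≡mkℚ (ℤ.- x) with x
... | + 0      = refl
... | + suc n  = refl
... | -[1+ n ] = refl

⟦⟧-homo-- : ∀ x y → ⟦ x ℤ.- y ⟧ ≡ ⟦ x ⟧ ℚ.- ⟦ y ⟧
⟦⟧-homo-- x y = trans (⟦⟧-homo-+ x (ℤ.- y)) (cong (⟦ x ⟧ ℚ.+_) (⟦⟧-homo‿- y))

⟦⟧-mono-≤ : ∀ {x y} → x ℤ.≤ y → ⟦ x ⟧ ℚ.≤ ⟦ y ⟧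
⟦⟧-mono-≤ {x} {y} x≤y rewrite ⟦⟧≡mkℚ x | ⟦⟧≡mkℚ y =
  ℚ.*≤* (subst₂ ℤ._≤_ (sym (ℤ.*-identityʳ x)) (sym (ℤ.*-identityʳ y)) x≤y)

⟦⟧-cancel-≤ : ∀ {x y} → ⟦ x ⟧ ℚ.≤ ⟦ y ⟧ → x ℤ.≤ y
⟦⟧-cancel-≤ {x} {y} x≤y rewrite ⟦⟧≡mkℚ x | ⟦⟧≡mkℚ y with x≤y
... | ℚ.*≤* x*1≤y*1 = subst₂ ℤ._≤_ (ℤ.*-identityʳ x) (ℤ.*-identityʳ y) x*1≤y*1

⟦⟧-cancel-< : ∀ {x y} → ⟦ x ⟧ ℚ.< ⟦ y ⟧ → x ℤ.< y
⟦⟧-cancel-< {x} {y} x<y rewrite ⟦⟧≡mkℚ x | ⟦⟧≡mkℚ y with x<y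
... | ℚ.*<* x*1<y*1 = subst₂ ℤ._<_ (ℤ.*-identityʳ x) (ℤ.*-identityʳ y) x*1<y*1

0<i<1-impossible : ∀ {i} → + 0 ℤ.< i → i ℤ.< + 1 → ⊥
0<i<1-impossible {+ 0}     (ℤ.+<+ ())
0<i<1-impossible {+ suc _} _ (ℤ.+<+ (ℕ.s≤s ()))

0≤i≤1⇒i≡0⊎i≡1 : ∀ {i} → + 0 ℤ.≤ i → i ℤ.≤ + 1 → i ≡ + 0 ⊎ i ≡ + 1
0≤i≤1⇒i≡0⊎i≡1 {+ 0}           _ _                    = inj₁ refl
0≤i≤1⇒i≡0⊎i≡1 {+ 1}           _ _                    = inj₂ refl
0≤i≤1⇒i≡0⊎i≡1 {+ suc (suc _)} _ (ℤ.+≤+ (ℕ.s≤s ()))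

0≤i≤+n⇒i≡+k : ∀ {i n} → + 0 ℤ.≤ i → i ℤ.≤ + n → ∃[ k ] (i ≡ + k × k ≤ n)
0≤i≤+n⇒i≡+k {+ k} _ (ℤ.+≤+ k≤n) = k , refl , k≤n

det : Point → Point → ℤ
det (a , b) (c , d) = a ℤ.* d ℤ.- b ℤ.* c

_+_∙_ : Point → ℤ → Point → Point
(a , b) + k ∙ (c , d) = (a ℤ.+ k ℤ.* c , b ℤ.+ k ℤ.* d)

Unimodular : ℤ → Set
Unimodular e = e ℤ.* e ≡ + 1

det-shear : ∀ u k v → det v (u + k ∙ v) ≡ ℤ.- det u v
det-shear (a , b) k (c , d) =
  solve 5 (λ a b c d k → c :* (b :+ k :* d) :- d :* (a :+ k :* c) := :- (a :* d :- b :* c))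
    refl a b c d k
  where open +-*-Solver

unimodular-neg : ∀ e → Unimodular e → Unimodular (ℤ.- e)
unimodular-neg e = trans (solve 1 (λ e → (:- e) :* (:- e) := e :* e) refl e)
  where open +-*-Solver

V-unimodular : ∀ qs k → Unimodular (det (V qs k) (V qs (suc k)))
V-unimodular qs 0       = refl
V-unimodular qs (suc k) =
  subst Unimodular (sym (det-shear (V qs k) (+ qAt qs k) (V qs (suc k))))
    (unimodular-neg (det (V qs k) (V qs (suc k))) (V-unimodular qs k))

record IsCombination (α : ℚ) (u : Point) (β : ℚ) (v : Point) (p : Point) : Set where
  constructor combination
  field
    x-equation : ⟦ proj₁ p ⟧ ≡ α ℚ.* ⟦ proj₁ u ⟧ ℚ.+ β ℚ.* ⟦ proj₁ v ⟧
    y-equation : ⟦ proj₂ p ⟧ ≡ α ℚ.* ⟦ proj₂ u ⟧ ℚ.+ β ℚ.* ⟦ proj₂ v ⟧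

⟦det⟧ : ∀ u v → ⟦ det u v ⟧ ≡ ⟦ proj₁ u ⟧ ℚ.* ⟦ proj₂ v ⟧ ℚ.- ⟦ proj₂ u ⟧ ℚ.* ⟦ proj₁ v ⟧
⟦det⟧ (a , b) (c , d) =
  trans (⟦⟧-homo-- (a ℤ.* d) (b ℤ.* c)) (cong₂ ℚ._-_ (⟦⟧-homo-* a d) (⟦⟧-homo-* b c))

module _ {α β : ℚ} {u v : Point} where
  open ℚ-Solver using (solve; _:+_; _:*_; _:-_; _:=_)

  combination-det-left : ∀ {p} → IsCombination α u β v p → ⟦ det p v ⟧ ≡ α ℚ.* ⟦ det u v ⟧
  combination-det-left {p@(x , y)} (combination px py) = begin
    ⟦ det p v ⟧                                       ≡⟨ ⟦det⟧ p v ⟩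
    ⟦ x ⟧ ℚ.* ⟦ d ⟧ ℚ.- ⟦ y ⟧ ℚ.* ⟦ c ⟧               ≡⟨ cong₂ (λ X Y → X ℚ.* ⟦ d ⟧ ℚ.- Y ℚ.* ⟦ c ⟧) px py ⟩
    (α ℚ.* ⟦ a ⟧ ℚ.+ β ℚ.* ⟦ c ⟧) ℚ.* ⟦ d ⟧
      ℚ.- (α ℚ.* ⟦ b ⟧ ℚ.+ β ℚ.* ⟦ d ⟧) ℚ.* ⟦ c ⟧    ≡⟨ solve 6 (λ α β a b c d →
                                                           (α :* a :+ β :* c) :* d :- (α :* b :+ β :* d) :* c
                                                             := α :* (a :* d :- b :* c))
                                                         refl α β ⟦ a ⟧ ⟦ b ⟧ ⟦ c ⟧ ⟦ d ⟧ ⟩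
    α ℚ.* (⟦ a ⟧ ℚ.* ⟦ d ⟧ ℚ.- ⟦ b ⟧ ℚ.* ⟦ c ⟧)       ≡⟨ cong (α ℚ.*_) (⟦det⟧ u v) ⟨
    α ℚ.* ⟦ det u v ⟧                                 ∎
    where a = proj₁ u; b = proj₂ u; c = proj₁ v; d = proj₂ v

  combination-det-right : ∀ {p} → IsCombination α u β v p → ⟦ det u p ⟧ ≡ β ℚ.* ⟦ det u v ⟧
  combination-det-right {p@(x , y)} (combination px py) = begin
    ⟦ det u p ⟧                                       ≡⟨ ⟦det⟧ u p ⟩
    ⟦ a ⟧ ℚ.* ⟦ y ⟧ ℚ.- ⟦ b ⟧ ℚ.* ⟦ x ⟧               ≡⟨ cong₂ (λ X Y → ⟦ a ⟧ ℚ.* Y ℚ.- ⟦ b ⟧ ℚ.* X) px py ⟩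
    ⟦ a ⟧ ℚ.* (α ℚ.* ⟦ b ⟧ ℚ.+ β ℚ.* ⟦ d ⟧)
      ℚ.- ⟦ b ⟧ ℚ.* (α ℚ.* ⟦ a ⟧ ℚ.+ β ℚ.* ⟦ c ⟧)    ≡⟨ solve 6 (λ α β a b c d →
                                                           a :* (α :* b :+ β :* d) :- b :* (α :* a :+ β :* c)
                                                             := β :* (a :* d :- b :* c))
                                                         refl α β ⟦ a ⟧ ⟦ b ⟧ ⟦ c ⟧ ⟦ d ⟧ ⟩
    β ℚ.* (⟦ a ⟧ ℚ.* ⟦ d ⟧ ℚ.- ⟦ b ⟧ ℚ.* ⟦ c ⟧)       ≡⟨ cong (β ℚ.*_) (⟦det⟧ u v) ⟨
    β ℚ.* ⟦ det u v ⟧                                 ∎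
    where a = proj₁ u; b = proj₂ u; c = proj₁ v; d = proj₂ v

unimodular-solve : ∀ e z {α} → Unimodular e → ⟦ z ⟧ ≡ α ℚ.* ⟦ e ⟧ → α ≡ ⟦ e ℤ.* z ⟧
unimodular-solve e z {α} ee=1 z=αe = begin
  α                             ≡⟨ ℚ.*-identityʳ α ⟨
  α ℚ.* ⟦ + 1 ⟧                 ≡⟨ cong (λ r → α ℚ.* ⟦ r ⟧) ee=1 ⟨
  α ℚ.* ⟦ e ℤ.* e ⟧             ≡⟨ cong (α ℚ.*_) (⟦⟧-homo-* e e) ⟩
  α ℚ.* (⟦ e ⟧ ℚ.* ⟦ e ⟧)       ≡⟨ solve 2 (λ α E → α :* (E :* E) := E :* (α :* E)) refl α ⟦ e ⟧ ⟩
  ⟦ e ⟧ ℚ.* (α ℚ.* ⟦ e ⟧)       ≡⟨ cong (⟦ e ⟧ ℚ.*_) z=αe ⟨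
  ⟦ e ⟧ ℚ.* ⟦ z ⟧               ≡⟨ ⟦⟧-homo-* e z ⟨
  ⟦ e ℤ.* z ⟧                   ∎
  where open ℚ-Solver using (solve; _:*_; _:=_)

combination-coordinates : ∀ {α β u v p} → Unimodular (det u v) → IsCombination α u β v p →
  α ≡ ⟦ det u v ℤ.* det p v ⟧ × β ≡ ⟦ det u v ℤ.* det u p ⟧
combination-coordinates {u = u} {v} {p} U p=αu+βv =
  unimodular-solve (det u v) (det p v) U (combination-det-left p=αu+βv) ,
  unimodular-solve (det u v) (det u p) U (combination-det-right p=αu+βv)

⟦⟧-homo-shear : ∀ x k y → ⟦ x ℤ.+ k ℤ.* y ⟧ ≡ ⟦ x ⟧ ℚ.+ ⟦ k ⟧ ℚ.* ⟦ y ⟧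
⟦⟧-homo-shear x k y = trans (⟦⟧-homo-+ x (k ℤ.* y)) (cong (⟦ x ⟧ ℚ.+_) (⟦⟧-homo-* k y))

shear-regroup : ∀ s t x k y →
  s ℚ.* ⟦ x ⟧ ℚ.+ t ℚ.* ⟦ x ℤ.+ k ℤ.* y ⟧ ≡ (s ℚ.+ t) ℚ.* ⟦ x ⟧ ℚ.+ (t ℚ.* ⟦ k ⟧) ℚ.* ⟦ y ⟧
shear-regroup s t x k y = begin
  s ℚ.* ⟦ x ⟧ ℚ.+ t ℚ.* ⟦ x ℤ.+ k ℤ.* y ⟧              ≡⟨ cong (λ r → s ℚ.* ⟦ x ⟧ ℚ.+ t ℚ.* r) (⟦⟧-homo-shear x k y) ⟩
  s ℚ.* ⟦ x ⟧ ℚ.+ t ℚ.* (⟦ x ⟧ ℚ.+ ⟦ k ⟧ ℚ.* ⟦ y ⟧)    ≡⟨ solve 5 (λ s t X K Y → s :* X :+ t :* (X :+ K :* Y)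
                                                                      := (s :+ t) :* X :+ (t :* K) :* Y)
                                                          refl s t ⟦ x ⟧ ⟦ k ⟧ ⟦ y ⟧ ⟩
  (s ℚ.+ t) ℚ.* ⟦ x ⟧ ℚ.+ (t ℚ.* ⟦ k ⟧) ℚ.* ⟦ y ⟧       ∎
  where open ℚ-Solver using (solve; _:+_; _:*_; _:=_)

combination-shear : ∀ {s t u v p} k → IsCombination s u t (u + k ∙ v) p →
  IsCombination (s ℚ.+ t) u (t ℚ.* ⟦ k ⟧) v p
combination-shear {s} {t} {a , b} {c , d} k (combination px py) =
  combination (trans px (shear-regroup s t a k c)) (trans py (shear-regroup s t b k d))

combination-unshear : ∀ {s t u v p} k → IsCombination (s ℚ.+ t) u (t ℚ.* ⟦ k ⟧) v p →
  IsCombination s u t (u + k ∙ v) p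
combination-unshear {s} {t} {a , b} {c , d} k (combination px py) =
  combination (trans px (sym (shear-regroup s t a k c))) (trans py (sym (shear-regroup s t b k d)))

shear-combination : ∀ u k v → IsCombination 1ℚ u ⟦ k ⟧ v (u + k ∙ v)
shear-combination (a , b) k (c , d) = combination (coordinate a c) (coordinate b d)
  where
  coordinate : ∀ x y → ⟦ x ℤ.+ k ℤ.* y ⟧ ≡ 1ℚ ℚ.* ⟦ x ⟧ ℚ.+ ⟦ k ⟧ ℚ.* ⟦ y ⟧
  coordinate x y = trans (⟦⟧-homo-shear x k y) (cong (ℚ._+ ⟦ k ⟧ ℚ.* ⟦ y ⟧) (sym (ℚ.*-identityˡ ⟦ x ⟧)))

combination⇒shear : ∀ {u v p} k → IsCombination 1ℚ u ⟦ k ⟧ v p → p ≡ u + k ∙ v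
combination⇒shear {u} {v} k (combination px py) with combination qx qy ← shear-combination u k v =
  cong₂ _,_ (⟦⟧-injective (trans px (sym qx))) (⟦⟧-injective (trans py (sym qy)))

combination-zero : ∀ {u v p} → IsCombination 0ℚ u 0ℚ v p → p ≡ (+ 0 , + 0)
combination-zero {a , b} {c , d} (combination px py) =
  cong₂ _,_ (⟦⟧-injective (trans px (vanish a c))) (⟦⟧-injective (trans py (vanish b d)))
  where
  vanish : ∀ x y → 0ℚ ℚ.* ⟦ x ⟧ ℚ.+ 0ℚ ℚ.* ⟦ y ⟧ ≡ 0ℚ
  vanish x y = cong₂ ℚ._+_ (ℚ.*-zeroˡ ⟦ x ⟧) (ℚ.*-zeroˡ ⟦ y ⟧)

fraction-in-unit-interval : ∀ {j q} → j ≤ q →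
  ∃[ t ] (0ℚ ℚ.≤ t × t ℚ.≤ 1ℚ × t ℚ.* ⟦ + q ⟧ ≡ ⟦ + j ⟧)
fraction-in-unit-interval {q = 0} ℕ.z≤n = 0ℚ , ℚ.≤-refl , ⟦⟧-mono-≤ {+ 0} {+ 1} (ℤ.+≤+ ℕ.z≤n) , refl
fraction-in-unit-interval {j} {q@(suc _)} j≤q = t , 0≤t , t≤1 , t*Q≡j
  where
  Q = ⟦ + q ⟧
  instance
    Q-positive : ℚ.Positive Q
    Q-positive = ℚ.normalize-pos q 1
    Q-nonZero : ℚ.NonZero Q
    Q-nonZero = ℚ.pos⇒nonZero Q
  t = ⟦ + j ⟧ ℚ.÷ Q
  t*Q≡j : t ℚ.* Q ≡ ⟦ + j ⟧
  t*Q≡j = begin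
    ⟦ + j ⟧ ℚ.* ℚ.1/ Q ℚ.* Q     ≡⟨ ℚ.*-assoc ⟦ + j ⟧ (ℚ.1/ Q) Q ⟩
    ⟦ + j ⟧ ℚ.* (ℚ.1/ Q ℚ.* Q)   ≡⟨ cong (⟦ + j ⟧ ℚ.*_) (ℚ.*-inverseˡ Q) ⟩
    ⟦ + j ⟧ ℚ.* 1ℚ               ≡⟨ ℚ.*-identityʳ ⟦ + j ⟧ ⟩
    ⟦ + j ⟧                      ∎
  0≤t : 0ℚ ℚ.≤ t
  0≤t = ℚ.*-cancelʳ-≤-pos Q
    (subst₂ ℚ._≤_ (sym (ℚ.*-zeroˡ Q)) (sym t*Q≡j) (⟦⟧-mono-≤ {+ 0} {+ j} (ℤ.+≤+ ℕ.z≤n)))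
  t≤1 : t ℚ.≤ 1ℚ
  t≤1 = ℚ.*-cancelʳ-≤-pos Q
    (subst₂ ℚ._≤_ (sym t*Q≡j) (sym (ℚ.*-identityˡ Q)) (⟦⟧-mono-≤ (ℤ.+≤+ j≤q)))

1-t+t≡1 : ∀ t → (1ℚ ℚ.- t) ℚ.+ t ≡ 1ℚ
1-t+t≡1 t = solve 1 (λ t → (con 1ℚ :- t) :+ t := con 1ℚ) refl t
  where open ℚ-Solver using (solve; _:+_; _:-_; _:=_; con)

combination⇒onSegment : ∀ {t u w p} → 0ℚ ℚ.≤ t → t ℚ.≤ 1ℚ → IsCombination (1ℚ ℚ.- t) u t w p →
  OnSegment u w p
combination⇒onSegment {t} 0≤t t≤1 (combination px py) = t , 0≤t , t≤1 , px , py

shear-onSegment : ∀ u v {j q} → j ≤ q → OnSegment u (u + + q ∙ v) (u + + j ∙ v)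
shear-onSegment u v {j} {q} j≤q with t , 0≤t , t≤1 , t*q≡j ← fraction-in-unit-interval j≤q =
  combination⇒onSegment 0≤t t≤1
    (combination-unshear (+ q)
      (subst₂ (λ α β → IsCombination α u β v (u + + j ∙ v))
        (sym (1-t+t≡1 t)) (sym t*q≡j) (shear-combination u (+ j) v)))

onSegment-shear : ∀ {u v q p} → Unimodular (det u v) → OnSegment u (u + + q ∙ v) p →
  ∃[ j ] (j ≤ q × p ≡ u + + j ∙ v)
onSegment-shear {u} {v} {q} {p} U (t , 0≤t , t≤1 , px , py) = lattice-point (0≤i≤+n⇒i≡+k 0≤B B≤q)
  where
  instance
    q-nonNeg : ℚ.NonNegative ⟦ + q ⟧
    q-nonNeg = ℚ.normalize-nonNeg q 1
  p=u+tqv : IsCombination 1ℚ u (t ℚ.* ⟦ + q ⟧) v p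
  p=u+tqv = subst (λ α → IsCombination α u (t ℚ.* ⟦ + q ⟧) v p) (1-t+t≡1 t)
    (combination-shear {1ℚ ℚ.- t} {t} (+ q) (combination px py))
  B = det u v ℤ.* det u p
  t*q≡B : t ℚ.* ⟦ + q ⟧ ≡ ⟦ B ⟧
  t*q≡B = proj₂ (combination-coordinates U p=u+tqv)
  0≤B : + 0 ℤ.≤ B
  0≤B = ⟦⟧-cancel-≤ (subst₂ ℚ._≤_ (ℚ.*-zeroˡ ⟦ + q ⟧) t*q≡B (ℚ.*-monoʳ-≤-nonNeg ⟦ + q ⟧ 0≤t))
  B≤q : B ℤ.≤ + q
  B≤q = ⟦⟧-cancel-≤ (subst₂ ℚ._≤_ t*q≡B (ℚ.*-identityˡ ⟦ + q ⟧) (ℚ.*-monoʳ-≤-nonNeg ⟦ + q ⟧ t≤1))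
  lattice-point : ∃[ j ] (B ≡ + j × j ≤ q) → ∃[ j ] (j ≤ q × p ≡ u + + j ∙ v)
  lattice-point (j , B≡j , j≤q) =
    j , j≤q , combination⇒shear (+ j)
      (subst (λ β → IsCombination 1ℚ u β v p) (trans t*q≡B (cong ⟦_⟧ B≡j)) p=u+tqv)

nonNeg+nonNeg≡0 : ∀ {s t} → 0ℚ ℚ.≤ s → 0ℚ ℚ.≤ t → s ℚ.+ t ≡ 0ℚ → s ≡ 0ℚ × t ≡ 0ℚ
nonNeg+nonNeg≡0 {s} {t} 0≤s 0≤t s+t≡0 =
  ℚ.≤-antisym (subst₂ ℚ._≤_ (ℚ.+-identityʳ s) s+t≡0 (ℚ.+-monoʳ-≤ s 0≤t)) 0≤s ,
  ℚ.≤-antisym (subst₂ ℚ._≤_ (ℚ.+-identityˡ t) s+t≡0 (ℚ.+-monoˡ-≤ t 0≤s)) 0≤t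

shear-injective : ∀ {u v i j} → Unimodular (det u v) → u + i ∙ v ≡ u + j ∙ v → i ≡ j
shear-injective {u} {v} {i} {j} U eq = ⟦⟧-injective (begin
  ⟦ i ⟧                                    ≡⟨ proj₂ (combination-coordinates U (shear-combination u i v)) ⟩
  ⟦ det u v ℤ.* det u (u + i ∙ v) ⟧        ≡⟨ cong (λ p → ⟦ det u v ℤ.* det u p ⟧) eq ⟩
  ⟦ det u v ℤ.* det u (u + j ∙ v) ⟧        ≡⟨ proj₂ (combination-coordinates U (shear-combination u j v)) ⟨
  ⟦ j ⟧                                    ∎)

module _ (u v : Point) (U : Unimodular (det u v)) (q : ℕ) where

  segment-lattice-points : ∃[ L ] (Unique L × All (OnSegment u (u + + q ∙ v)) L
    × (∀ p → OnSegment u (u + + q ∙ v) p → p ∈ L) × length L ≡ suc q)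
  segment-lattice-points = L , unique , all-onSegment , complete , List.length-applyUpTo shear (suc q)
    where
    shear : ℕ → Point
    shear j = u + + j ∙ v
    L = applyUpTo shear (suc q)
    unique : Unique L
    unique = Unique.applyUpTo⁺₁ shear (suc q) λ {i} {j} i<j _ eq →
      ℕ.<⇒≢ i<j (ℤ.+-injective (shear-injective {u} {v} {+ i} {+ j} U eq))
    all-onSegment : All (OnSegment u (u + + q ∙ v)) L
    all-onSegment = All.applyUpTo⁺₁ shear (suc q) λ {j} j<1+q →
      shear-onSegment u v {j} {q} (ℕ.≤-pred j<1+q)
    member : ∀ {p} → ∃[ j ] (j ≤ q × p ≡ shear j) → p ∈ L
    member (j , j≤q , p≡shear) = subst (_∈ L) (sym p≡shear) (∈-applyUpTo⁺ shear (ℕ.s≤s j≤q))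
    complete : ∀ p → OnSegment u (u + + q ∙ v) p → p ∈ L
    complete p p∈uw = member {p} (onSegment-shear {u} {v} {q} {p} U p∈uw)

  triangle-coordinate : ∀ {s t p} → IsCombination s u t (u + + q ∙ v) p →
    s ℚ.+ t ≡ ⟦ det u v ℤ.* det p v ⟧
  triangle-coordinate p∈T = proj₁ (combination-coordinates U (combination-shear (+ q) p∈T))

  triangle-interior-empty : ∀ p → ¬ InInterior u (u + + q ∙ v) p
  triangle-interior-empty p (s , t , 0<s , 0<t , s+t<1 , px , py) =
    0<i<1-impossible {A} (⟦⟧-cancel-< (subst₂ ℚ._<_ (ℚ.+-identityʳ 0ℚ) s+t≡A (ℚ.+-mono-< 0<s 0<t)))
                         (⟦⟧-cancel-< (subst (ℚ._< 1ℚ) s+t≡A s+t<1))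
    where
    A = det u v ℤ.* det p v
    s+t≡A = triangle-coordinate {s} {t} {p} (combination px py)

  triangle-lattice-points : ∀ p → InTriangle u (u + + q ∙ v) p → p ≢ (+ 0 , + 0) →
    OnSegment u (u + + q ∙ v) p
  triangle-lattice-points p (s , t , 0≤s , 0≤t , s+t≤1 , px , py) p≢0 =
    onSegment (0≤i≤1⇒i≡0⊎i≡1 {A}
      (⟦⟧-cancel-≤ (subst₂ ℚ._≤_ (ℚ.+-identityʳ 0ℚ) s+t≡A (ℚ.+-mono-≤ 0≤s 0≤t)))
      (⟦⟧-cancel-≤ (subst (ℚ._≤ 1ℚ) s+t≡A s+t≤1)))
    where
    A = det u v ℤ.* det p v
    p∈T : IsCombination s u t (u + + q ∙ v) p
    p∈T = combination px py
    s+t≡A = triangle-coordinate p∈T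
    onSegment : A ≡ + 0 ⊎ A ≡ + 1 → OnSegment u (u + + q ∙ v) p
    onSegment (inj₁ A≡0) = ⊥-elim (p≢0 (combination-zero
      (subst₂ (λ α β → IsCombination α u β (u + + q ∙ v) p) (proj₁ s,t≡0) (proj₂ s,t≡0) p∈T)))
      where s,t≡0 = nonNeg+nonNeg≡0 0≤s 0≤t (trans s+t≡A (cong ⟦_⟧ A≡0))
    onSegment (inj₂ A≡1) = combination⇒onSegment 0≤t t≤1
      (subst (λ α → IsCombination α u t (u + + q ∙ v) p) s≡1-t p∈T)
      where
      s+t≡1 : s ℚ.+ t ≡ 1ℚ
      s+t≡1 = trans s+t≡A (cong ⟦_⟧ A≡1)
      t≤1 : t ℚ.≤ 1ℚ
      t≤1 = subst₂ ℚ._≤_ (ℚ.+-identityˡ t) s+t≡1 (ℚ.+-monoˡ-≤ t 0≤s)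
      s≡1-t : s ≡ 1ℚ ℚ.- t
      s≡1-t = trans (solve 2 (λ s t → s := (s :+ t) :- t) refl s t) (cong (ℚ._- t) s+t≡1)
        where open ℚ-Solver using (solve; _:+_; _:-_; _:=_)

lookup≡qAt : ∀ (qs : List ℕ) (i : Fin (length qs)) → lookup qs i ≡ qAt qs (toℕ i)
lookup≡qAt (q ∷ qs) Fin.zero    = refl
lookup≡qAt (q ∷ qs) (Fin.suc i) = lookup≡qAt qs i

lemma18 : (a n : ℕ) → 1 ≤ a → a < n → gcd a n ≡ 1 →
    (i : Fin (length (cf n a))) →
      (∃[ L ] (Unique L
          × All (OnSegment (V (cf n a) (toℕ i)) (V (cf n a) (suc (suc (toℕ i))))) L
          × (∀ p → OnSegment (V (cf n a) (toℕ i)) (V (cf n a) (suc (suc (toℕ i)))) p → p ∈ L)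
          × length L ≡ suc (lookup (cf n a) i)))
      × (∀ p → ¬ InInterior (V (cf n a) (toℕ i)) (V (cf n a) (suc (suc (toℕ i)))) p)
      × (∀ p → InTriangle (V (cf n a) (toℕ i)) (V (cf n a) (suc (suc (toℕ i)))) p
           → p ≢ (+ 0 , + 0) → p ≢ V (cf n a) (toℕ i) → p ≢ V (cf n a) (suc (suc (toℕ i)))
           → OnSegment (V (cf n a) (toℕ i)) (V (cf n a) (suc (suc (toℕ i)))) p)
lemma18 a n _ _ _ i rewrite lookup≡qAt (cf n a) i =
  segment-lattice-points u v U q ,
  triangle-interior-empty u v U q ,
  λ p p∈T p≢0 _ _ → triangle-lattice-points u v U q p p∈T p≢0
  where
  u = V (cf n a) (toℕ i)
  v = V (cf n a) (suc (toℕ i))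
  U = V-unimodular (cf n a) (toℕ i)
  q = qAt (cf n a) (toℕ i)
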